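{- The following fourteen mesh patterns $(12,R)$ are pairwise equidistributed, where $R$ ranges over: $\{(0,2),(1,2),(2,2),(0,1),(1,1)\}$, $\{(0,2),(1,2),(0,1),(1,1),(0,0)\}$, $\{(2,2),(1,1),(2,1),(1,0),(2,0)\}$, $\{(1,1),(2,1),(0,0),(1,0),(2,0)\}$, $\{(0,2),(1,2),(2,2),(0,1),(0,0)\}$, $\{(2,2),(2,1),(0,0),(1,0),(2,0)\}$, $\{(0,2),(2,2),(0,1),(2,1),(0,0)\}$, $\{(0,2),(1,2),(2,2),(0,0),(1,0)\}$, $\{(2,2),(0,1),(2,1),(0,0),(2,0)\}$, $\{(1,2),(2,2),(0,0),(1,0),(2,0)\}$, $\{(0,2),(0,1),(1,1),(2,1),(0,0)\}$, $\{(0,2),(1,2),(2,2),(1,1),(1,0)\}$, $\{(2,2),(0,1),(1,1),(2,1),(2,0)\}$, $\{(1,2),(1,1),(0,0),(1,0),(2,0)\}$. Moreover, for each such pattern $p$ and $n\ge1$, $\sum_{\pi\in S_n}q^{p(\pi)}=(n-1)!+q\,(n-1)(n-1)!$.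
   Context: For $R\subseteq\{0,1,2\}^2$ and $\pi=\pi_1\cdots\pi_n\in S_n$, an occurrence of the mesh pattern $(12,R)$ in $\pi$ is a pair of positions $i_1<i_2$ with $\pi_{i_1}<\pi_{i_2}$ such that, setting $x_0=0,x_1=i_1,x_2=i_2,x_3=n+1$ and $y_0=0,y_1=\pi_{i_1},y_2=\pi_{i_2},y_3=n+1$, for every $(a,b)\in R$ there is no index $k$ with $x_a<k<x_{a+1}$ and $y_b<\pi_k<y_{b+1}$. $p(\pi)$ is the number of occurrences of $p$ in $\pi$; $s_{n,k}(p)$ the number of $\pi\in S_n$ with $p(\pi)=k$; $p_1,p_2$ are equidistributed if $s_{n,k}(p_1)=s_{n,k}(p_2)$ for all $n,k\ge 0$. -}

module Defs where

open import Data.Nat using (ℕ; zero; suc; _+_; _*_; _∸_; _^_; _<ᵇ_; _≡ᵇ_)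

open import Data.Bool using (Bool; true; false; _∧_; not; if_then_else_)
open import Data.Fin using (Fin; toℕ; inject₁; _≟_) renaming (zero to fz; suc to fs)
open import Data.Vec using (Vec; []; _∷_; lookup)
open import Data.List using (List; []; _∷_; map; concatMap; allFin)
open import Data.Nat.ListAction using (sum)
open import Data.Bool.ListAction using (any; all)
open import Data.Product using (_×_; _,_)
open import Relation.Nullary.Decidable using (⌊_⌋)

-- A permutation π ∈ S_n is represented in one-line notation as a vector
-- π = (π_1 … π_n) of entries in Fin n (entry j : Fin n stands for value toℕ j + 1)
-- whose entries are pairwise distinct.

words : (m n : ℕ) → List (Vec (Fin n) m)
words zero    n = [] ∷ []
words (suc m) n = concatMap (λ i → map (i ∷_) (words m n)) (allFin n)

distinct : ∀ {n m} → Vec (Fin n) m → Bool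
distinct []       = true
distinct (x ∷ xs) = not (anyV x xs) ∧ distinct xs
  where
  anyV : ∀ {n k} → Fin n → Vec (Fin n) k → Bool
  anyV x []       = false
  anyV x (y ∷ ys) = ⌊ x ≟ y ⌋ Data.Bool.∨ anyV x ys

perms : (n : ℕ) → List (Vec (Fin n) n)
perms n = filterᵇ (words n n)
  where
  filterᵇ : List (Vec (Fin n) n) → List (Vec (Fin n) n)
  filterᵇ []       = []
  filterᵇ (v ∷ vs) = if distinct v then v ∷ filterᵇ vs else filterᵇ vs

countᵇ : ∀ {A : Set} → (A → Bool) → List A → ℕ
countᵇ P []       = 0
countᵇ P (x ∷ xs) = (if P x then 1 else 0) + countᵇ P xs

-- A mesh pattern (12, R) is given by its shaded set R ⊆ {0,1,2}², as a list of boxes (a , b).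
Shading : Set
Shading = List (Fin 3 × Fin 3)

pos : ∀ {n} → Fin n → ℕ
pos i = suc (toℕ i)

val : ∀ {n} → Vec (Fin n) n → Fin n → ℕ
val π i = suc (toℕ (lookup π i))

isOcc : ∀ {n} → Shading → Vec (Fin n) n → Fin n → Fin n → Bool
isOcc {n} R π i₁ i₂ =
  (pos i₁ <ᵇ pos i₂) ∧ (val π i₁ <ᵇ val π i₂) ∧ all boxEmpty R
  where
  xs : Vec ℕ 4
  xs = 0 ∷ pos i₁ ∷ pos i₂ ∷ suc n ∷ []
  ys : Vec ℕ 4
  ys = 0 ∷ val π i₁ ∷ val π i₂ ∷ suc n ∷ []
  boxEmpty : Fin 3 × Fin 3 → Bool
  boxEmpty (a , b) = not (any inBox (allFin n))
    where
    inBox : Fin n → Bool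
    inBox k = (lookup xs (inject₁ a) <ᵇ pos k) ∧ (pos k <ᵇ lookup xs (fs a))
            ∧ (lookup ys (inject₁ b) <ᵇ val π k) ∧ (val π k <ᵇ lookup ys (fs b))

occ : ∀ {n} → Shading → Vec (Fin n) n → ℕ
occ {n} R π = countᵇ (λ ij → isOcc R π (Data.Product.proj₁ ij) (Data.Product.proj₂ ij))
                     (concatMap (λ i → map (λ j → (i , j)) (allFin n)) (allFin n))

s : Shading → ℕ → ℕ → ℕ
s R n k = countᵇ (λ π → occ R π ≡ᵇ k) (perms n)

Equidistributed : Shading → Shading → Set
Equidistributed R₁ R₂ = ∀ n k → s R₁ n k ≡ s R₂ n k
  where open import Relation.Binary.PropositionalEquality using (_≡_)

genPoly : Shading → ℕ → ℕ → ℕ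
genPoly R n q = sum (map (λ π → q ^ occ R π) (perms n))

private
  z o t : Fin 3
  z = fz
  o = fs fz
  t = fs (fs fz)

patterns : Vec Shading 14
patterns =
    ((z , t) ∷ (o , t) ∷ (t , t) ∷ (z , o) ∷ (o , o) ∷ [])
  ∷ ((z , t) ∷ (o , t) ∷ (z , o) ∷ (o , o) ∷ (z , z) ∷ [])
  ∷ ((t , t) ∷ (o , o) ∷ (t , o) ∷ (o , z) ∷ (t , z) ∷ [])
  ∷ ((o , o) ∷ (t , o) ∷ (z , z) ∷ (o , z) ∷ (t , z) ∷ [])
  ∷ ((z , t) ∷ (o , t) ∷ (t , t) ∷ (z , o) ∷ (z , z) ∷ [])
  ∷ ((t , t) ∷ (t , o) ∷ (z , z) ∷ (o , z) ∷ (t , z) ∷ [])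
  ∷ ((z , t) ∷ (t , t) ∷ (z , o) ∷ (t , o) ∷ (z , z) ∷ [])
  ∷ ((z , t) ∷ (o , t) ∷ (t , t) ∷ (z , z) ∷ (o , z) ∷ [])
  ∷ ((t , t) ∷ (z , o) ∷ (t , o) ∷ (z , z) ∷ (t , z) ∷ [])
  ∷ ((o , t) ∷ (t , t) ∷ (z , z) ∷ (o , z) ∷ (t , z) ∷ [])
  ∷ ((z , t) ∷ (z , o) ∷ (o , o) ∷ (t , o) ∷ (z , z) ∷ [])
  ∷ ((z , t) ∷ (o , t) ∷ (t , t) ∷ (o , o) ∷ (o , z) ∷ [])
  ∷ ((t , t) ∷ (z , o) ∷ (o , o) ∷ (t , o) ∷ (t , z) ∷ [])
  ∷ ((o , t) ∷ (o , o) ∷ (z , z) ∷ (o , z) ∷ (t , z) ∷ [])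
  ∷ []

{-# OPTIONS --safe #-}

-- Each of the fourteen patterns p has the following property: a permutation π ∈ S_n,
-- n ≥ 1, contains p exactly once, unless the diagram of π has its point in a certain
-- corner (π_1 = n for seven of the patterns, π_n = 1 for the other seven), in which
-- case it does not contain p at all. As (n - 1)! permutations have a prescribed entry,
-- p(π) = 0 for (n - 1)! permutations and p(π) = 1 for the other (n - 1)(n - 1)!.
--
-- Transposing the diagram (π ↦ π⁻¹) and turning it by a half-turn (reverse-complement)
-- both exchange the two corners, and every pattern is the image under these of one of
-- four patterns that shade the whole top row. Shading the top row forces the second
-- point of an occurrence to be the top point n; the two remaining boxes single out the
-- first point among those left of n: the first point of π, the highest or lowest point
-- left of n, or the point immediately left of n. There is such a point unless π_1 = n.

module Submission where

open import Defs

open import Data.Bool using (Bool; true; false; not; _∧_; _∨_; if_then_else_; T)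
open import Data.Bool.ListAction using (any)
open import Data.Bool.Properties using (if-float; T-∧; ∧-identityʳ; ∧-zeroʳ; ∧-assoc; ∨-zeroʳ)
open import Data.Empty using (⊥-elim)
open import Data.Fin using (Fin; toℕ; fromℕ; fromℕ<; inject₁; opposite; punchIn; punchOut; _≟_)
  renaming (zero to fz; suc to fs)
open import Data.Fin.Patterns using (0F; 1F; 2F)
open import Data.Fin.Properties
  using (any?; injective⇒≤; toℕ<n; toℕ≤pred[n]; toℕ-injective; toℕ-fromℕ; toℕ-fromℕ<
        ; punchInᵢ≢i; punchIn-injective; punchIn-punchOut; punchOut-injective)
open import Data.List using (List; []; _∷_; _++_; map; concatMap; tabulate; allFin; filter)
open import Data.List.Extrema.Nat
  using (argmax; argmin; argmax-all; argmin-all; f[xs]≤f[argmax]; f[argmin]≤f[xs])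
open import Data.List.Membership.Propositional using (_∈_; lose)
open import Data.List.Membership.Propositional.Properties using (∈-filter⁺; ∈-allFin)
open import Data.List.Relation.Unary.All as All using (All; []; _∷_)
open import Data.List.Relation.Unary.All.Properties using (all-filter; map⁺; map⁻; anti-mono; all⁺; all⁻)
open import Data.List.Relation.Unary.Any using (satisfied)
open import Data.List.Relation.Unary.Any.Properties using (any⁺; any⁻)
open import Data.Nat using (ℕ; zero; suc; _+_; _*_; _∸_; _^_; _≤_; _<_; _!; _<ᵇ_; _≡ᵇ_
                           ; z≤n; s≤s; s≤s⁻¹; >-nonZero)
open import Data.Nat.ListAction using (sum)
open import Data.Nat.Properties
  using (+-assoc; +-identityʳ; +-cancelˡ-≡; *-identityʳ; *-comm; suc-injective; suc-pred; pred[n]≤n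
        ; ≤-refl; ≤-trans; ≤-antisym; <-irrefl; <-trans; <-cmp; _<?_
        ; <⇒≢; <⇒≱; ≰⇒>; ≮⇒≥; ≤∧≢⇒<
        ; n≮0; n≢0⇒n>0; n≤0⇒n≡0; 1+n≰n; <ᵇ⇒<; <⇒<ᵇ
        ; m∸n≤m; m∸[m∸n]≡n; n∸n≡0; ∸-cancelˡ-≡; ∸-monoʳ-<; ∸-monoʳ-≤
        ; +-0-commutativeMonoid; +-commutativeSemigroup)
open import Algebra.Properties.CommutativeMonoid.Sum +-0-commutativeMonoid
  using (sum-syntax; sum-cong-≗; sum-remove; sum-replicate-zero)
open import Algebra.Properties.CommutativeSemigroup +-commutativeSemigroup using (x∙yz≈y∙xz)
open import Data.Product as Σ using (_×_; _,_; proj₁; proj₂; ∃-syntax; ∃!; swap)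
open import Data.Product.Function.NonDependent.Propositional using (_×-⇔_)
open import Data.Product.Properties using (≡-dec)
open import Data.List.Relation.Binary.Subset.DecPropositional (≡-dec (_≟_ {3}) (_≟_ {3}))
  using (_⊆_; _⊆?_)
open import Data.Vec using (Vec; []; _∷_; lookup) renaming (map to vmap)
open import Data.Vec.Properties using (lookup-map)
open import Data.Vec.Relation.Unary.All using ([]; _∷_) renaming (All to VecAll)
open import Data.Vec.Relation.Unary.All.Properties using (lookup⁺)
open import Function using (id; _∘_; _⇔_; mk⇔; Equivalence)
open import Function.Definitions using (Injective)
open import Function.Properties.Equivalence using () renaming (sym to ⇔-sym; refl to ⇔-refl)
open import Relation.Binary.Definitions using (tri<; tri≈; tri>)
open import Relation.Binary.PropositionalEquality
  using (_≡_; _≢_; _≗_; ≢-sym; refl; sym; trans; cong; cong₂; subst; module ≡-Reasoning)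
open import Relation.Nullary using (¬_; Dec; yes; no)
open import Relation.Nullary.Decidable
  using (⌊_⌋; True; toWitness; T?; _×-dec_; dec-true; dec-false; does-⇔; isYes≗does)
open import Relation.Unary using (Decidable)

open ≡-Reasoning

-- Finite sums and counting

∑-const : ∀ k c → ∑[ i < k ] c ≡ k * c
∑-const zero    c = refl
∑-const (suc k) c = cong (c +_) (∑-const k c)

∑-single : ∀ {k} (a : Fin (suc k)) (t : Fin (suc k) → ℕ) →
           (∀ j → t (punchIn a j) ≡ 0) → ∑[ i < suc k ] t i ≡ t a
∑-single {k} a t t≡0 = begin
  ∑[ i < suc k ] t i              ≡⟨ sum-remove t ⟩
  t a + ∑[ j < k ] t (punchIn a j) ≡⟨ cong (t a +_) (trans (sum-cong-≗ t≡0) (sum-replicate-zero k)) ⟩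
  t a + 0                         ≡⟨ +-identityʳ (t a) ⟩
  t a                             ∎

module _ {A : Set} where

  countᵇ-++ : ∀ P (xs ys : List A) → countᵇ P (xs ++ ys) ≡ countᵇ P xs + countᵇ P ys
  countᵇ-++ P []       ys = refl
  countᵇ-++ P (x ∷ xs) ys =
    trans (cong (_ +_) (countᵇ-++ P xs ys)) (sym (+-assoc (if P x then 1 else 0) _ _))

  countᵇ-cong : ∀ {P Q : A → Bool} → P ≗ Q → countᵇ P ≗ countᵇ Q
  countᵇ-cong P≗Q []       = refl
  countᵇ-cong P≗Q (x ∷ xs) = cong₂ (λ b n → (if b then 1 else 0) + n) (P≗Q x) (countᵇ-cong P≗Q xs)

  countᵇ-none : ∀ {P : A → Bool} → (∀ x → P x ≡ false) → ∀ xs → countᵇ P xs ≡ 0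
  countᵇ-none P≡false []       = refl
  countᵇ-none P≡false (x ∷ xs) rewrite P≡false x = countᵇ-none P≡false xs

  countᵇ-map : ∀ {B : Set} (P : B → Bool) (f : A → B) xs → countᵇ P (map f xs) ≡ countᵇ (P ∘ f) xs
  countᵇ-map P f []       = refl
  countᵇ-map P f (x ∷ xs) = cong (_ +_) (countᵇ-map P f xs)

  countᵇ-tabulate : ∀ {k} (P : A → Bool) (f : Fin k → A) →
                    countᵇ P (tabulate f) ≡ ∑[ i < k ] (if P (f i) then 1 else 0)
  countᵇ-tabulate {zero}  P f = refl
  countᵇ-tabulate {suc k} P f = cong (_ +_) (countᵇ-tabulate P (f ∘ fs))

  countᵇ-concatMap : ∀ {B : Set} {k} (P : A → Bool) (h : B → List A) (f : Fin k → B) →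
                     countᵇ P (concatMap h (tabulate f)) ≡ ∑[ i < k ] countᵇ P (h (f i))
  countᵇ-concatMap {k = zero}  P h f = refl
  countᵇ-concatMap {k = suc k} P h f =
    trans (countᵇ-++ P (h (f fz)) _) (cong (_ +_) (countᵇ-concatMap P h (f ∘ fs)))

countᵇ-as-sum : ∀ {A : Set} (P : A → Bool) xs → countᵇ P xs ≡ sum (map (λ x → if P x then 1 else 0) xs)
countᵇ-as-sum P []       = refl
countᵇ-as-sum P (x ∷ xs) = cong (_ +_) (countᵇ-as-sum P xs)

countᵇ-∧-split : ∀ {A : Set} (D C : A → Bool) xs →
                 countᵇ (λ x → D x ∧ C x) xs + countᵇ (λ x → D x ∧ not (C x)) xs ≡ countᵇ D xs
countᵇ-∧-split D C []       = refl
countᵇ-∧-split D C (x ∷ xs) with D x | C x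
... | false | _     = countᵇ-∧-split D C xs
... | true  | true  = cong suc (countᵇ-∧-split D C xs)
... | true  | false = trans (sym (x∙yz≈y∙xz 1 _ _)) (cong suc (countᵇ-∧-split D C xs))

countᵇ-words : ∀ m k (P : Vec (Fin k) (suc m) → Bool) →
               countᵇ P (words (suc m) k) ≡ ∑[ i < k ] countᵇ (P ∘ (i ∷_)) (words m k)
countᵇ-words m k P = trans (countᵇ-concatMap P (λ i → map (i ∷_) (words m k)) id)
                           (sum-cong-≗ (λ i → countᵇ-map P (i ∷_) (words m k)))

countᵇ-allFin-unique : ∀ {n} (P : Fin (suc n) → Bool) → ∃! _≡_ (T ∘ P) →
                       countᵇ P (allFin (suc n)) ≡ 1
countᵇ-allFin-unique {n} P (a , Pa , a-unique) = begin
  countᵇ P (allFin (suc n))                ≡⟨ countᵇ-tabulate P id ⟩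
  ∑[ i < suc n ] (if P i then 1 else 0)    ≡⟨ ∑-single a (λ i → if P i then 1 else 0)
                                                (λ j → cong (if_then 1 else 0) (P[punchIn]≡false j)) ⟩
  (if P a then 1 else 0)                   ≡⟨ cong (if_then 1 else 0) (dec-true (T? (P a)) Pa) ⟩
  1                                        ∎
  where
  P[punchIn]≡false : ∀ j → P (punchIn a j) ≡ false
  P[punchIn]≡false j = dec-false (T? _) (λ P[punchIn] → punchInᵢ≢i a j (sym (a-unique P[punchIn])))

allPairs : ∀ n → List (Fin n × Fin n)
allPairs n = concatMap (λ i → map (λ j → (i , j)) (allFin n)) (allFin n)

countᵇ-allPairs-unique : ∀ {n} (P : Fin (suc n) × Fin (suc n) → Bool) → ∃! _≡_ (T ∘ P) →
                         countᵇ P (allPairs (suc n)) ≡ 1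
countᵇ-allPairs-unique {n} P ((i₀ , j₀) , P₀ , unique) = begin
  countᵇ P (concatMap row (allFin (suc n)))       ≡⟨ countᵇ-concatMap P row id ⟩
  ∑[ i < suc n ] countᵇ P (row i)                 ≡⟨ ∑-single i₀ (countᵇ P ∘ row) other-row ⟩
  countᵇ P (row i₀)                               ≡⟨ countᵇ-map P (i₀ ,_) (allFin (suc n)) ⟩
  countᵇ (P ∘ (i₀ ,_)) (allFin (suc n))           ≡⟨ countᵇ-allFin-unique _ (j₀ , P₀ , cong proj₂ ∘ unique) ⟩
  1                                               ∎
  where
  row : Fin (suc n) → List (Fin (suc n) × Fin (suc n))
  row i = map (i ,_) (allFin (suc n))
  other-row : ∀ j → countᵇ P (row (punchIn i₀ j)) ≡ 0
  other-row j = trans (countᵇ-map P _ (allFin (suc n)))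
    (countᵇ-none (λ k → dec-false (T? _) (λ Pjk → punchInᵢ≢i i₀ j (sym (cong proj₁ (unique Pjk)))))
                 (allFin (suc n)))

-- Words without repeated letters

⌊⌋-yes : ∀ {A : Set} (a? : Dec A) → A → ⌊ a? ⌋ ≡ true
⌊⌋-yes a? a = trans (isYes≗does a?) (dec-true a? a)

⌊⌋-no : ∀ {A : Set} (a? : Dec A) → ¬ A → ⌊ a? ⌋ ≡ false
⌊⌋-no a? ¬a = trans (isYes≗does a?) (dec-false a? ¬a)

⌊⌋-⇔ : ∀ {A B : Set} → A ⇔ B → (a? : Dec A) (b? : Dec B) → ⌊ a? ⌋ ≡ ⌊ b? ⌋
⌊⌋-⇔ A⇔B a? b? = trans (isYes≗does a?) (trans (does-⇔ A⇔B a? b?) (sym (isYes≗does b?)))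

T-not⇔¬T : ∀ {b} → T (not b) ⇔ (¬ T b)
T-not⇔¬T {false} = mk⇔ (λ _ ()) _
T-not⇔¬T {true}  = mk⇔ (λ ()) (λ ¬t → ¬t _)

_∈ᵇ_ : ∀ {n k} → Fin n → Vec (Fin n) k → Bool
x ∈ᵇ []       = false
x ∈ᵇ (y ∷ ys) = ⌊ x ≟ y ⌋ ∨ x ∈ᵇ ys

-- The membership test local to `distinct` cannot be referred to by name. It is
-- captured as the solution of the metavariable `distinct-member`, which checking
-- `distinct-∷∷` determines; abstracting `y ∷ zs` there makes the constraint a pattern.
mutual
  private
    distinct-member : ∀ {n m k} → Fin n → Vec (Fin n) m → Vec (Fin n) k → Bool
    distinct-member = _

    distinct-∷∷ : ∀ {n k} (x y : Fin n) (zs : Vec (Fin n) k) →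
                  distinct (x ∷ y ∷ zs)
                  ≡ not (⌊ x ≟ y ⌋ ∨ distinct-member x (y ∷ zs) zs) ∧ distinct (y ∷ zs)
    distinct-∷∷ {k = k} x y zs with suc k | y ∷ zs
    ... | _ | ys = refl

private
  distinct-member≡∈ᵇ : ∀ {n m k} (x : Fin n) (ys : Vec (Fin n) m) (zs : Vec (Fin n) k) →
                       distinct-member x ys zs ≡ x ∈ᵇ zs
  distinct-member≡∈ᵇ x ys []       = refl
  distinct-member≡∈ᵇ x ys (z ∷ zs) = cong (⌊ x ≟ z ⌋ ∨_) (distinct-member≡∈ᵇ x ys zs)

distinct-∷ : ∀ {n k} (x : Fin n) (xs : Vec (Fin n) k) →
             distinct (x ∷ xs) ≡ not (x ∈ᵇ xs) ∧ distinct xs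
distinct-∷ x xs = cong (λ b → not b ∧ distinct xs) (distinct-member≡∈ᵇ x xs xs)

∈ᵇ-lookup : ∀ {n k} (xs : Vec (Fin n) k) l → lookup xs l ∈ᵇ xs ≡ true
∈ᵇ-lookup (x ∷ xs) fz     = cong (_∨ x ∈ᵇ xs) (⌊⌋-yes (x ≟ x) refl)
∈ᵇ-lookup (x ∷ xs) (fs l) rewrite ∈ᵇ-lookup xs l = ∨-zeroʳ _

∈ᵇ-map : ∀ {n k m} {f : Fin n → Fin k} → Injective _≡_ _≡_ f →
         ∀ x (xs : Vec (Fin n) m) → f x ∈ᵇ vmap f xs ≡ x ∈ᵇ xs
∈ᵇ-map f-inj x []       = refl
∈ᵇ-map f-inj x (y ∷ ys) =
  cong₂ _∨_ (⌊⌋-⇔ (mk⇔ f-inj (cong _)) (_ ≟ _) (x ≟ y)) (∈ᵇ-map f-inj x ys)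

distinct-map : ∀ {n k m} {f : Fin n → Fin k} → Injective _≡_ _≡_ f →
               (xs : Vec (Fin n) m) → distinct (vmap f xs) ≡ distinct xs
distinct-map f-inj []       = refl
distinct-map {f = f} f-inj (x ∷ xs) rewrite distinct-∷ (f x) (vmap f xs) | distinct-∷ x xs =
  cong₂ (λ b d → not b ∧ d) (∈ᵇ-map f-inj x xs) (distinct-map f-inj xs)

distinct⇒lookup-injective : ∀ {n k} (xs : Vec (Fin n) k) → T (distinct xs) → Injective _≡_ _≡_ (lookup xs)
distinct⇒lookup-injective (x ∷ xs) d {fz}   {fz}   _ = refl
distinct⇒lookup-injective (x ∷ xs) d {fz}   {fs l} x≡xs[l]
  rewrite distinct-∷ x xs | x≡xs[l] | ∈ᵇ-lookup xs l = ⊥-elim d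
distinct⇒lookup-injective (x ∷ xs) d {fs k} {fz}   xs[k]≡x
  rewrite distinct-∷ x xs | sym xs[k]≡x | ∈ᵇ-lookup xs k = ⊥-elim d
distinct⇒lookup-injective (x ∷ xs) d {fs k} {fs l} eq
  rewrite distinct-∷ x xs = cong fs (distinct⇒lookup-injective xs (proj₂ (Equivalence.to T-∧ d)) eq)

countᵇ-words-avoiding : ∀ m k (a : Fin (suc k)) (Q : Vec (Fin (suc k)) m → Bool) →
                        countᵇ (λ w → not (a ∈ᵇ w) ∧ Q w) (words m (suc k))
                        ≡ countᵇ (Q ∘ vmap (punchIn a)) (words m k)
countᵇ-words-avoiding zero    k a Q = refl
countᵇ-words-avoiding (suc m) k a Q = begin
  countᵇ (λ w → not (a ∈ᵇ w) ∧ Q w) (words (suc m) (suc k)) ≡⟨ countᵇ-words m (suc k) _ ⟩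
  ∑[ i < suc k ] t i                                         ≡⟨ sum-remove t ⟩
  t a + ∑[ j < k ] t (punchIn a j)                           ≡⟨ cong₂ _+_ t[a]≡0 (sum-cong-≗ t[punchIn]) ⟩
  ∑[ j < k ] countᵇ (Q ∘ vmap (punchIn a) ∘ (j ∷_)) (words m k) ≡⟨ countᵇ-words m k _ ⟨
  countᵇ (Q ∘ vmap (punchIn a)) (words (suc m) k)            ∎
  where
  t : Fin (suc k) → ℕ
  t i = countᵇ (λ w → not (⌊ a ≟ i ⌋ ∨ a ∈ᵇ w) ∧ Q (i ∷ w)) (words m (suc k))
  t[a]≡0 : t a ≡ 0
  t[a]≡0 rewrite ⌊⌋-yes (a ≟ a) refl = countᵇ-none (λ _ → refl) (words m (suc k))
  t[punchIn] : ∀ j → t (punchIn a j) ≡ countᵇ (Q ∘ vmap (punchIn a) ∘ (j ∷_)) (words m k)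
  t[punchIn] j rewrite ⌊⌋-no (a ≟ punchIn a j) (punchInᵢ≢i a j ∘ sym) =
    countᵇ-words-avoiding m k a (Q ∘ (punchIn a j ∷_))

countᵇ-distinct-∷ : ∀ m k (a : Fin (suc k)) (Q : Vec (Fin (suc k)) m → Bool) →
                    countᵇ (λ w → distinct (a ∷ w) ∧ Q w) (words m (suc k))
                    ≡ countᵇ (λ w → distinct w ∧ Q (vmap (punchIn a) w)) (words m k)
countᵇ-distinct-∷ m k a Q = begin
  countᵇ (λ w → distinct (a ∷ w) ∧ Q w) (words m (suc k))
    ≡⟨ countᵇ-cong (λ w → trans (cong (_∧ Q w) (distinct-∷ a w)) (∧-assoc (not (a ∈ᵇ w)) _ _))
                   (words m (suc k)) ⟩
  countᵇ (λ w → not (a ∈ᵇ w) ∧ (distinct w ∧ Q w)) (words m (suc k))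
    ≡⟨ countᵇ-words-avoiding m k a _ ⟩
  countᵇ (λ w → distinct (vmap (punchIn a) w) ∧ Q (vmap (punchIn a) w)) (words m k)
    ≡⟨ countᵇ-cong (λ w → cong (_∧ Q (vmap (punchIn a) w)) (distinct-map (punchIn-injective a _ _) w))
                   (words m k) ⟩
  countᵇ (λ w → distinct w ∧ Q (vmap (punchIn a) w)) (words m k) ∎

#distinct : ℕ → ℕ → ℕ
#distinct m k = countᵇ distinct (words m k)

#distinct-suc : ∀ m k → #distinct (suc m) (suc k) ≡ suc k * #distinct m k
#distinct-suc m k = begin
  #distinct (suc m) (suc k)                               ≡⟨ countᵇ-words m (suc k) distinct ⟩
  ∑[ i < suc k ] countᵇ (distinct ∘ (i ∷_)) (words m (suc k)) ≡⟨ sum-cong-≗ term ⟩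
  ∑[ i < suc k ] #distinct m k                            ≡⟨ ∑-const (suc k) _ ⟩
  suc k * #distinct m k                                   ∎
  where
  term : ∀ i → countᵇ (distinct ∘ (i ∷_)) (words m (suc k)) ≡ #distinct m k
  term i = begin
    countᵇ (distinct ∘ (i ∷_)) (words m (suc k))
      ≡⟨ countᵇ-cong (λ w → sym (∧-identityʳ _)) (words m (suc k)) ⟩
    countᵇ (λ w → distinct (i ∷ w) ∧ true) (words m (suc k))
      ≡⟨ countᵇ-distinct-∷ m k i (λ _ → true) ⟩
    countᵇ (λ w → distinct w ∧ true) (words m k)
      ≡⟨ countᵇ-cong (λ w → ∧-identityʳ _) (words m k) ⟩
    #distinct m k ∎

#distinct-n-n : ∀ n → #distinct n n ≡ n !
#distinct-n-n zero    = refl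
#distinct-n-n (suc n) = trans (#distinct-suc n n) (cong (suc n *_) (#distinct-n-n n))

distinct-∷-lookup : ∀ {n k} (w : Vec (Fin n) k) l → distinct (lookup w l ∷ w) ≡ false
distinct-∷-lookup w l rewrite distinct-∷ (lookup w l) w | ∈ᵇ-lookup w l = refl

mutual
  #distinct-fixing : ∀ m k (l : Fin (suc m)) (a : Fin (suc k)) →
                     countᵇ (λ w → distinct w ∧ ⌊ lookup w l ≟ a ⌋) (words (suc m) (suc k))
                     ≡ #distinct m k
  #distinct-fixing m k fz a = begin
    countᵇ (λ w → distinct w ∧ ⌊ lookup w fz ≟ a ⌋) (words (suc m) (suc k))
      ≡⟨ countᵇ-words m (suc k) _ ⟩
    ∑[ i < suc k ] t i  ≡⟨ ∑-single a t t[punchIn]≡0 ⟩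
    t a                 ≡⟨ t[a] ⟩
    #distinct m k       ∎
    where
    t : Fin (suc k) → ℕ
    t i = countᵇ (λ w → distinct (i ∷ w) ∧ ⌊ i ≟ a ⌋) (words m (suc k))
    t[punchIn]≡0 : ∀ j → t (punchIn a j) ≡ 0
    t[punchIn]≡0 j rewrite ⌊⌋-no (punchIn a j ≟ a) (punchInᵢ≢i a j) =
      countᵇ-none (λ w → ∧-zeroʳ (distinct (punchIn a j ∷ w))) (words m (suc k))
    t[a] : t a ≡ #distinct m k
    t[a] rewrite ⌊⌋-yes (a ≟ a) refl =
      trans (countᵇ-distinct-∷ m k a (λ _ → true)) (countᵇ-cong (λ _ → ∧-identityʳ _) (words m k))
  #distinct-fixing (suc m) k (fs l) a = begin
    countᵇ (λ w → distinct w ∧ ⌊ lookup w (fs l) ≟ a ⌋) (words (suc (suc m)) (suc k))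
      ≡⟨ countᵇ-words (suc m) (suc k) _ ⟩
    ∑[ i < suc k ] t i                ≡⟨ sum-remove t ⟩
    t a + ∑[ j < k ] t (punchIn a j)  ≡⟨ cong₂ _+_ t[a]≡0 (#distinct-fixing-other-heads m k l a) ⟩
    #distinct (suc m) k               ∎
    where
    t : Fin (suc k) → ℕ
    t i = countᵇ (λ w → distinct (i ∷ w) ∧ ⌊ lookup w l ≟ a ⌋) (words (suc m) (suc k))
    t[a]≡0 : t a ≡ 0
    t[a]≡0 = countᵇ-none a∉ (words (suc m) (suc k))
      where
      a∉ : ∀ w → distinct (a ∷ w) ∧ ⌊ lookup w l ≟ a ⌋ ≡ false
      a∉ w with lookup w l ≟ a
      ... | yes refl = cong (_∧ true) (distinct-∷-lookup w l)
      ... | no _     = ∧-zeroʳ _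

  #distinct-fixing-other-heads : ∀ m k (l : Fin (suc m)) (a : Fin (suc k)) →
    ∑[ j < k ] countᵇ (λ w → distinct (punchIn a j ∷ w) ∧ ⌊ lookup w l ≟ a ⌋) (words (suc m) (suc k))
    ≡ #distinct (suc m) k
  #distinct-fixing-other-heads m zero    l a = refl
  #distinct-fixing-other-heads m (suc k) l a =
    trans (sum-cong-≗ term) (trans (∑-const (suc k) _) (sym (#distinct-suc m k)))
    where
    term : ∀ j → countᵇ (λ w → distinct (punchIn a j ∷ w) ∧ ⌊ lookup w l ≟ a ⌋)
                        (words (suc m) (suc (suc k)))
                 ≡ #distinct m k
    term j = begin
      countᵇ (λ w → distinct (i ∷ w) ∧ ⌊ lookup w l ≟ a ⌋) (words (suc m) (suc (suc k)))
        ≡⟨ countᵇ-distinct-∷ (suc m) (suc k) i _ ⟩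
      countᵇ (λ w → distinct w ∧ ⌊ lookup (vmap (punchIn i) w) l ≟ a ⌋) (words (suc m) (suc k))
        ≡⟨ countᵇ-cong (λ w → cong (distinct w ∧_) (entry w)) (words (suc m) (suc k)) ⟩
      countᵇ (λ w → distinct w ∧ ⌊ lookup w l ≟ b ⌋) (words (suc m) (suc k))
        ≡⟨ #distinct-fixing m k l b ⟩
      #distinct m k ∎
      where
      i = punchIn a j
      i≢a : i ≢ a
      i≢a = punchInᵢ≢i a j
      b = punchOut i≢a
      entry : ∀ w → ⌊ lookup (vmap (punchIn i) w) l ≟ a ⌋ ≡ ⌊ lookup w l ≟ b ⌋
      entry w rewrite lookup-map l (punchIn i) w =
        ⌊⌋-⇔ (mk⇔ (λ e → punchIn-injective i _ _ (trans e (sym (punchIn-punchOut i≢a))))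
                  (λ e → trans (cong (punchIn i) e) (punchIn-punchOut i≢a)))
             (punchIn i (lookup w l) ≟ a) (lookup w l ≟ b)

#perms-fixing : ∀ m (l a : Fin (suc m)) →
                countᵇ (λ w → distinct w ∧ ⌊ lookup w l ≟ a ⌋) (words (suc m) (suc m)) ≡ m !
#perms-fixing m l a = trans (#distinct-fixing m m l a) (#distinct-n-n m)

-- Likewise for the filter local to `perms`.
mutual
  private
    keepDistinct : (n : ℕ) → List (Vec (Fin n) n) → List (Vec (Fin n) n)
    keepDistinct n = _

    perms-keepDistinct : ∀ n → perms n ≡ keepDistinct n (words n n)
    perms-keepDistinct n with words n n
    ... | ws = refl

sum-perms-twoValued : ∀ n (f : Vec (Fin n) n → ℕ) (C : Vec (Fin n) n → Bool) (u v : ℕ) →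
                      (∀ π → T (distinct π) → f π ≡ (if C π then u else v)) →
                      sum (map f (perms n))
                      ≡ countᵇ (λ w → distinct w ∧ C w) (words n n) * u
                        + countᵇ (λ w → distinct w ∧ not (C w)) (words n n) * v
sum-perms-twoValued n f C u v f-twoValued rewrite perms-keepDistinct n = go (words n n)
  where
  go : ∀ ws → sum (map f (keepDistinct n ws))
              ≡ countᵇ (λ w → distinct w ∧ C w) ws * u + countᵇ (λ w → distinct w ∧ not (C w)) ws * v
  go []       = refl
  go (w ∷ ws) with distinct w in d | C w in c
  ... | false | _     = go ws
  ... | true  | true  rewrite f-twoValued w (subst T (sym d) _) | c =
    trans (cong (u +_) (go ws)) (sym (+-assoc u _ _))
  ... | true  | false rewrite f-twoValued w (subst T (sym d) _) | c =
    trans (cong (v +_) (go ws)) (x∙yz≈y∙xz v (countᵇ (λ w → distinct w ∧ C w) ws * u) _)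

sum-perms-by-entry : ∀ m (l a : Fin (suc m)) (f : Vec (Fin (suc m)) (suc m) → ℕ) (u v : ℕ) →
                     (∀ π → T (distinct π) → f π ≡ (if ⌊ lookup π l ≟ a ⌋ then u else v)) →
                     sum (map f (perms (suc m))) ≡ m ! * u + (m * m !) * v
sum-perms-by-entry m l a f u v f-twoValued = begin
  sum (map f (perms (suc m)))   ≡⟨ sum-perms-twoValued (suc m) f C u v f-twoValued ⟩
  #fixed * u + #unfixed * v     ≡⟨ cong₂ (λ p q → p * u + q * v) (#perms-fixing m l a) #unfixed≡ ⟩
  m ! * u + (m * m !) * v       ∎
  where
  C : Vec (Fin (suc m)) (suc m) → Bool
  C w = ⌊ lookup w l ≟ a ⌋
  #fixed #unfixed : ℕ
  #fixed   = countᵇ (λ w → distinct w ∧ C w) (words (suc m) (suc m))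
  #unfixed = countᵇ (λ w → distinct w ∧ not (C w)) (words (suc m) (suc m))
  #unfixed≡ : #unfixed ≡ m * m !
  #unfixed≡ = +-cancelˡ-≡ (m !) #unfixed (m * m !) (begin
    m ! + #unfixed             ≡⟨ cong (_+ #unfixed) (#perms-fixing m l a) ⟨
    #fixed + #unfixed          ≡⟨ countᵇ-∧-split distinct C (words (suc m) (suc m)) ⟩
    #distinct (suc m) (suc m)  ≡⟨ #distinct-n-n (suc m) ⟩
    suc m !                    ∎)

-- Permutation diagrams

module _ {n} (f : Fin n → ℕ) {P : Fin n → Set} (P? : Decidable P) where

  private
    candidates : List (Fin n)
    candidates = filter P? (allFin n)

    ∈-candidates : ∀ {j} → P j → j ∈ candidates
    ∈-candidates Pj = ∈-filter⁺ P? (∈-allFin _) Pj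

  maximiser : ∀ {k} → P k → ∃[ i ] P i × (∀ {j} → P j → f j ≤ f i)
  maximiser {k} Pk = argmax f k candidates
                   , argmax-all f Pk (all-filter P? (allFin n))
                   , λ Pj → All.lookup (f[xs]≤f[argmax] k candidates) (∈-candidates Pj)

  minimiser : ∀ {k} → P k → ∃[ i ] P i × (∀ {j} → P j → f i ≤ f j)
  minimiser {k} Pk = argmin f k candidates
                   , argmin-all f Pk (all-filter P? (allFin n))
                   , λ Pj → All.lookup (f[argmin]≤f[xs] k candidates) (∈-candidates Pj)

injective⇒onto : ∀ {n} {f : Fin n → Fin n} → Injective _≡_ _≡_ f → ∀ y → ∃[ k ] f k ≡ y
injective⇒onto {suc n} {f} f-inj y with any? (λ k → f k ≟ y)
... | yes hit = hit
... | no miss = ⊥-elim (1+n≰n (injective⇒≤ g-inj))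
  where
  y≢f : ∀ k → y ≢ f k
  y≢f k y≡fk = miss (k , sym y≡fk)
  g : Fin (suc n) → Fin n
  g k = punchOut (y≢f k)
  g-inj : Injective _≡_ _≡_ g
  g-inj {k} {l} = f-inj ∘ punchOut-injective (y≢f k) (y≢f l)

-- The points of a diagram of size m + 1 are Fin (suc m); a coordinate maps them
-- injectively, hence (by `onto`) bijectively, onto [0, m].
record Coordinate (m : ℕ) : Set where
  field
    value     : Fin (suc m) → ℕ
    value≤m   : ∀ k → value k ≤ m
    injective : Injective _≡_ _≡_ value

open Coordinate

onto : ∀ {m} (X : Coordinate m) {c} → c ≤ m → ∃[ k ] value X k ≡ c
onto X {c} c≤m =
  Σ.map₂ (λ eq → trans (asFin≡ eq) (toℕ-fromℕ< _))
         (injective⇒onto asFin-injective (fromℕ< (s≤s c≤m)))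
  where
  asFin : Fin _ → Fin _
  asFin k = fromℕ< (s≤s (value≤m X k))
  asFin≡ : ∀ {k} {d : Fin _} → asFin k ≡ d → value X k ≡ toℕ d
  asFin≡ eq = trans (sym (toℕ-fromℕ< _)) (cong toℕ eq)
  asFin-injective : Injective _≡_ _≡_ asFin
  asFin-injective eq = injective X (trans (asFin≡ eq) (toℕ-fromℕ< _))

reverse : ∀ {m} → Coordinate m → Coordinate m
reverse {m} X = record
  { value     = λ k → m ∸ value X k
  ; value≤m   = λ k → m∸n≤m m (value X k)
  ; injective = injective X ∘ ∸-cancelˡ-≡ (value≤m X _) (value≤m X _)
  }

module _ {m} (X : Coordinate m) where

  private
    x = value X

  nothing-below⇒≡0 : ∀ {i} → (∀ k → ¬ x k < x i) → x i ≡ 0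
  nothing-below⇒≡0 {i} none with onto X z≤n
  ... | k , xk≡0 = n≤0⇒n≡0 (≮⇒≥ (λ 0<xi → none k (subst (_< x i) (sym xk≡0) 0<xi)))

  nothing-above⇒≡m : ∀ {j} → (∀ k → ¬ x j < x k) → x j ≡ m
  nothing-above⇒≡m {j} none with onto X ≤-refl
  ... | k , xk≡m = ≤-antisym (value≤m X j) (≮⇒≥ (λ xj<m → none k (subst (x j <_) (sym xk≡m) xj<m)))

  nothing-between⇒≡suc : ∀ {i j} → x i < x j → (∀ k → ¬ (x i < x k × x k < x j)) → x j ≡ suc (x i)
  nothing-between⇒≡suc {i} {j} xi<xj none with onto X (≤-trans xi<xj (value≤m X j))
  ... | k , xk≡1+xi = ≤-antisym (≮⇒≥ (λ 1+xi<xj → none k (between 1+xi<xj))) xi<xj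
    where
    between : suc (x i) < x j → x i < x k × x k < x j
    between 1+xi<xj = subst (x i <_) (sym xk≡1+xi) ≤-refl , subst (_< x j) (sym xk≡1+xi) 1+xi<xj

-- The paper's condition x_a < c < x_(a+1) with x_1 = lo and x_2 = hi; the outer
-- bounds x_0 and x_3 hold for every point and are omitted.
Strip : Fin 3 → ℕ → ℕ → ℕ → Set
Strip 0F lo hi c = c < lo
Strip 1F lo hi c = lo < c × c < hi
Strip 2F lo hi c = hi < c

strip-cover : ∀ {lo hi c} → lo < hi → c ≢ lo → c ≢ hi → ∃[ a ] Strip a lo hi c
strip-cover {lo} {hi} {c} lo<hi c≢lo c≢hi with <-cmp c lo | <-cmp c hi
... | tri< c<lo _ _ | _              = 0F , c<lo
... | tri≈ _ c≡lo _ | _              = ⊥-elim (c≢lo c≡lo)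
... | tri> _ _ lo<c | tri< c<hi _ _  = 1F , lo<c , c<hi
... | tri> _ _ _    | tri≈ _ c≡hi _  = ⊥-elim (c≢hi c≡hi)
... | tri> _ _ _    | tri> _ _ hi<c  = 2F , hi<c

strip-excludes : ∀ a {lo hi c} → lo < hi → Strip a lo hi c → c ≢ lo × c ≢ hi
strip-excludes 0F lo<hi c<lo          = <⇒≢ c<lo , <⇒≢ (<-trans c<lo lo<hi)
strip-excludes 1F lo<hi (lo<c , c<hi) = ≢-sym (<⇒≢ lo<c) , <⇒≢ c<hi
strip-excludes 2F lo<hi hi<c          = ≢-sym (<⇒≢ (<-trans lo<hi hi<c)) , ≢-sym (<⇒≢ hi<c)

∸-reverses-< : ∀ {m a b} → a ≤ m → b ≤ m → a < b ⇔ m ∸ b < m ∸ a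
∸-reverses-< {m} {a} {b} a≤m b≤m = mk⇔
  (λ a<b → ∸-monoʳ-< a<b b≤m)
  (λ m∸b<m∸a → ≰⇒> (λ b≤a → <⇒≱ m∸b<m∸a (∸-monoʳ-≤ m b≤a)))

m∸c≡a⇔c≡m∸a : ∀ {m a c} → c ≤ m → a ≤ m → m ∸ c ≡ a ⇔ c ≡ m ∸ a
m∸c≡a⇔c≡m∸a {m} {a} {c} c≤m a≤m = mk⇔
  (λ m∸c≡a → trans (sym (m∸[m∸n]≡n c≤m)) (cong (m ∸_) m∸c≡a))
  (λ c≡m∸a → trans (cong (m ∸_) c≡m∸a) (m∸[m∸n]≡n a≤m))

strip-reverse : ∀ {m} a {lo hi c} → lo ≤ m → hi ≤ m → c ≤ m →
                Strip (opposite a) lo hi c ⇔ Strip a (m ∸ hi) (m ∸ lo) (m ∸ c)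
strip-reverse 0F lo≤m hi≤m c≤m = ∸-reverses-< hi≤m c≤m
strip-reverse 1F lo≤m hi≤m c≤m =
  mk⇔ (λ (lo<c , c<hi) → to (∸-reverses-< c≤m hi≤m) c<hi , to (∸-reverses-< lo≤m c≤m) lo<c)
      (λ (l , r) → from (∸-reverses-< lo≤m c≤m) r , from (∸-reverses-< c≤m hi≤m) l)
  where open Equivalence
strip-reverse 2F lo≤m hi≤m c≤m = ∸-reverses-< c≤m lo≤m

Box : Set
Box = Fin 3 × Fin 3

rotateBox : Box → Box
rotateBox (a , b) = opposite a , opposite b

module Diagram {m : ℕ} (X Y : Coordinate m) where

  Point : Set
  Point = Fin (suc m)

  x y : Point → ℕ
  x = value X
  y = value Y

  InBox : Box → Point → Point → Point → Set
  InBox (a , b) i j k = Strip a (x i) (x j) (x k) × Strip b (y i) (y j) (y k)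

  BoxEmpty : Box → Point → Point → Set
  BoxEmpty box i j = ∀ k → ¬ InBox box i j k

  Occurs : Shading → Point × Point → Set
  Occurs R (i , j) = x i < x j × y i < y j × All (λ box → BoxEmpty box i j) R

  NoOccurrence UniqueOccurrence : Shading → Set
  NoOccurrence R     = ∀ p → ¬ Occurs R p
  UniqueOccurrence R = ∃! _≡_ (Occurs R)

  OccursOnceUnless : Set → Shading → Set
  OccursOnceUnless Bad R = (Bad → NoOccurrence R) × (¬ Bad → UniqueOccurrence R)

  PointAt : ℕ → ℕ → Set
  PointAt a b = ∃[ k ] x k ≡ a × y k ≡ b

  column-empty : ∀ {i j} a → x i < x j → y i < y j → (∀ b → BoxEmpty (a , b) i j) →
                 ∀ k → ¬ Strip a (x i) (x j) (x k)
  column-empty a xi<xj yi<yj empty k k∈a with strip-excludes a xi<xj k∈a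
  ... | xk≢xi , xk≢xj
    with strip-cover yi<yj (xk≢xi ∘ cong x ∘ injective Y) (xk≢xj ∘ cong x ∘ injective Y)
  ... | b , k∈b = empty b k (k∈a , k∈b)

data Corner : Set where
  topLeft bottomRight : Corner

oppositeCorner : Corner → Corner
oppositeCorner topLeft     = bottomRight
oppositeCorner bottomRight = topLeft

AtCorner : ∀ {m} → Corner → Coordinate m → Coordinate m → Set
AtCorner {m} topLeft     X Y = Diagram.PointAt X Y 0 m
AtCorner {m} bottomRight X Y = Diagram.PointAt X Y m 0

-- Patterns shading the top row

topRow : Shading
topRow = (0F , 2F) ∷ (1F , 2F) ∷ (2F , 2F) ∷ []

module _ {m} (X Y : Coordinate m) where
  open Diagram X Y

  row-empty : ∀ {i j} b → x i < x j → y i < y j → (∀ a → BoxEmpty (a , b) i j) →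
              ∀ k → ¬ Strip b (y i) (y j) (y k)
  row-empty b xi<xj yi<yj empty = Diagram.column-empty Y X b yi<yj xi<xj (λ a k → empty a k ∘ swap)

  WitnessFor : Shading → Point → Point → Set
  WitnessFor R t i = x i < x t × All (λ box → BoxEmpty box i t) R

  SinglesOut : Shading → Set
  SinglesOut R = ∀ {t} → y t ≡ m → 0 < x t → ∃! _≡_ (WitnessFor R t)

  below-top : ∀ {i t} → y t ≡ m → i ≢ t → y i < y t
  below-top {i} yt≡m i≢t =
    ≤∧≢⇒< (subst (y i ≤_) (sym yt≡m) (value≤m Y i)) (i≢t ∘ injective Y)

  left-of⇒≢ : ∀ {i t} → x i < x t → i ≢ t
  left-of⇒≢ xi<xt i≡t = <-irrefl (cong x i≡t) xi<xt

  above-top-empty : ∀ {i t} → y t ≡ m → ∀ a → BoxEmpty (a , 2F) i t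
  above-top-empty {t = t} yt≡m a k (_ , yt<yk) = <⇒≱ yt<yk (subst (y k ≤_) (sym yt≡m) (value≤m Y k))

  occurs-topRow⇒top : ∀ {R i j} → Occurs (topRow ++ R) (i , j) → y j ≡ m
  occurs-topRow⇒top (xi<xj , yi<yj , e₀ ∷ e₁ ∷ e₂ ∷ _) =
    nothing-above⇒≡m Y (row-empty 2F xi<xj yi<yj λ { 0F → e₀ ; 1F → e₁ ; 2F → e₂ })

  topRow-classified : ∀ R → SinglesOut R → OccursOnceUnless (AtCorner topLeft X Y) (topRow ++ R)
  topRow-classified R singlesOut = none , once
    where
    none : AtCorner topLeft X Y → NoOccurrence (topRow ++ R)
    none (k , xk≡0 , yk≡m) (i , j) occ@(xi<xj , _) with injective Y (trans (occurs-topRow⇒top occ) (sym yk≡m))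
    ... | refl = n≮0 (subst (x i <_) xk≡0 xi<xj)

    once : ¬ AtCorner topLeft X Y → UniqueOccurrence (topRow ++ R)
    once not-topLeft with onto Y ≤-refl
    ... | t , yt≡m with singlesOut yt≡m (n≢0⇒n>0 (λ xt≡0 → not-topLeft (t , xt≡0 , yt≡m)))
    ... | i , (xi<xt , empty) , i-unique = (i , t) , occurs , unique
      where
      occurs : Occurs (topRow ++ R) (i , t)
      occurs = xi<xt , below-top yt≡m (left-of⇒≢ xi<xt)
             , top 0F ∷ top 1F ∷ top 2F ∷ empty
        where
        top : ∀ a → BoxEmpty (a , 2F) i t
        top = above-top-empty yt≡m
      unique : ∀ {p} → Occurs (topRow ++ R) p → (i , t) ≡ p
      unique {i′ , j′} occ@(xi′<xj′ , _ , _ ∷ _ ∷ _ ∷ empty′)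
        with injective Y (trans (occurs-topRow⇒top occ) (sym yt≡m))
      ... | refl = cong (_, t) (i-unique (xi′<xj′ , empty′))

  row-strip-empty-left-of : ∀ {i t k} b → BoxEmpty (0F , b) i t → BoxEmpty (1F , b) i t →
                            x k < x t → k ≢ i → ¬ Strip b (y i) (y t) (y k)
  row-strip-empty-left-of {i} {t} {k} b e₀ e₁ xk<xt k≢i k∈b with <-cmp (x k) (x i)
  ... | tri< xk<xi _ _ = e₀ k (xk<xi , k∈b)
  ... | tri≈ _ xk≡xi _ = k≢i (injective X xk≡xi)
  ... | tri> _ _ xi<xk = e₁ k ((xi<xk , xk<xt) , k∈b)

  singlesOut-first : SinglesOut ((0F , 1F) ∷ (0F , 0F) ∷ [])
  singlesOut-first {t} yt≡m 0<xt with onto X z≤n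
  ... | i₀ , xi₀≡0 = i₀ , (subst (_< x t) (sym xi₀≡0) 0<xt , left 1F ∷ left 0F ∷ []) , unique
    where
    left : ∀ b → BoxEmpty (0F , b) i₀ t
    left b k (xk<xi₀ , _) = n≮0 (subst (x k <_) xi₀≡0 xk<xi₀)
    unique : ∀ {i} → WitnessFor ((0F , 1F) ∷ (0F , 0F) ∷ []) t i → i₀ ≡ i
    unique {i} (xi<xt , e₀₁ ∷ e₀₀ ∷ []) = injective X (trans xi₀≡0 (sym (nothing-below⇒≡0 X
      (column-empty 0F xi<xt (below-top yt≡m (left-of⇒≢ xi<xt))
        λ { 0F → e₀₀ ; 1F → e₀₁ ; 2F → above-top-empty yt≡m 0F }))))

  singlesOut-predecessor : SinglesOut ((1F , 1F) ∷ (1F , 0F) ∷ [])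
  singlesOut-predecessor {t} yt≡m 0<xt with onto X (≤-trans pred[n]≤n (value≤m X t))
  ... | i₀ , xi₀≡pred = i₀ , (xi₀<xt , middle 1F ∷ middle 0F ∷ []) , unique
    where
    xt≡1+xi₀ : x t ≡ suc (x i₀)
    xt≡1+xi₀ = trans (sym (suc-pred (x t) {{>-nonZero 0<xt}})) (cong suc (sym xi₀≡pred))
    xi₀<xt : x i₀ < x t
    xi₀<xt = subst (x i₀ <_) (sym xt≡1+xi₀) ≤-refl
    middle : ∀ b → BoxEmpty (1F , b) i₀ t
    middle b k ((xi₀<xk , xk<xt) , _) = <⇒≱ xi₀<xk (s≤s⁻¹ (subst (x k <_) xt≡1+xi₀ xk<xt))
    unique : ∀ {i} → WitnessFor ((1F , 1F) ∷ (1F , 0F) ∷ []) t i → i₀ ≡ i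
    unique {i} (xi<xt , e₁₁ ∷ e₁₀ ∷ []) = injective X (suc-injective (trans (sym xt≡1+xi₀)
      (nothing-between⇒≡suc X xi<xt (column-empty 1F xi<xt (below-top yt≡m (left-of⇒≢ xi<xt))
        λ { 0F → e₁₀ ; 1F → e₁₁ ; 2F → above-top-empty yt≡m 1F }))))

  singlesOut-highestBefore : SinglesOut ((0F , 1F) ∷ (1F , 1F) ∷ [])
  singlesOut-highestBefore {t} yt≡m 0<xt with onto X z≤n
  ... | k₀ , xk₀≡0 with maximiser y (λ k → x k <? x t) (subst (_< x t) (sym xk₀≡0) 0<xt)
  ... | i₀ , xi₀<xt , highest = i₀ , (xi₀<xt , empty₀₁ ∷ empty₁₁ ∷ []) , unique
    where
    empty₀₁ : BoxEmpty (0F , 1F) i₀ t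
    empty₀₁ k (xk<xi₀ , yi₀<yk , _) = <⇒≱ yi₀<yk (highest (<-trans xk<xi₀ xi₀<xt))
    empty₁₁ : BoxEmpty (1F , 1F) i₀ t
    empty₁₁ k ((_ , xk<xt) , yi₀<yk , _) = <⇒≱ yi₀<yk (highest xk<xt)
    unique : ∀ {i} → WitnessFor ((0F , 1F) ∷ (1F , 1F) ∷ []) t i → i₀ ≡ i
    unique {i} (xi<xt , e₀₁ ∷ e₁₁ ∷ []) =
      injective Y (≤-antisym (≮⇒≥ i₀-not-above) (highest xi<xt))
      where
      i₀-not-above : ¬ y i < y i₀
      i₀-not-above yi<yi₀ = row-strip-empty-left-of 1F e₀₁ e₁₁ xi₀<xt
        (λ i₀≡i → <-irrefl (cong y (sym i₀≡i)) yi<yi₀)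
        (yi<yi₀ , below-top yt≡m (left-of⇒≢ xi₀<xt))

  singlesOut-lowestBefore : SinglesOut ((0F , 0F) ∷ (1F , 0F) ∷ [])
  singlesOut-lowestBefore {t} yt≡m 0<xt with onto X z≤n
  ... | k₀ , xk₀≡0 with minimiser y (λ k → x k <? x t) (subst (_< x t) (sym xk₀≡0) 0<xt)
  ... | i₀ , xi₀<xt , lowest = i₀ , (xi₀<xt , empty₀₀ ∷ empty₁₀ ∷ []) , unique
    where
    empty₀₀ : BoxEmpty (0F , 0F) i₀ t
    empty₀₀ k (xk<xi₀ , yk<yi₀) = <⇒≱ yk<yi₀ (lowest (<-trans xk<xi₀ xi₀<xt))
    empty₁₀ : BoxEmpty (1F , 0F) i₀ t
    empty₁₀ k ((_ , xk<xt) , yk<yi₀) = <⇒≱ yk<yi₀ (lowest xk<xt)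
    unique : ∀ {i} → WitnessFor ((0F , 0F) ∷ (1F , 0F) ∷ []) t i → i₀ ≡ i
    unique {i} (xi<xt , e₀₀ ∷ e₁₀ ∷ []) =
      injective Y (≤-antisym (lowest xi<xt) (≮⇒≥ i₀-not-below))
      where
      i₀-not-below : ¬ y i₀ < y i
      i₀-not-below yi₀<yi = row-strip-empty-left-of 0F e₀₀ e₁₀ xi₀<xt
        (λ i₀≡i → <-irrefl (cong y i₀≡i) yi₀<yi) yi₀<yi

-- Symmetries of the diagram

∃!-transfer : ∀ {A : Set} {P Q : A → Set} (σ : A → A) → (∀ a → σ (σ a) ≡ a) →
              (∀ a → P a ⇔ Q (σ a)) → ∃! _≡_ P → ∃! _≡_ Q
∃!-transfer {Q = Q} σ σ-involutive P⇔Qσ (a , Pa , a-unique) =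
  σ a , to (P⇔Qσ a) Pa , λ {b} Qb →
    trans (cong σ (a-unique (from (P⇔Qσ (σ b)) (subst Q (sym (σ-involutive b)) Qb)))) (σ-involutive b)
  where open Equivalence

module _ {m} (X Y X′ Y′ : Coordinate m) where
  private
    module D  = Diagram X Y
    module D′ = Diagram X′ Y′

  occursOnceUnless-transfer : ∀ {Bad Bad′ R R′} (σ : D.Point × D.Point → D.Point × D.Point) →
                              (∀ p → σ (σ p) ≡ p) → (∀ p → D.Occurs R p ⇔ D′.Occurs R′ (σ p)) →
                              Bad′ ⇔ Bad → D.OccursOnceUnless Bad R → D′.OccursOnceUnless Bad′ R′
  occursOnceUnless-transfer {R′ = R′} σ σ-involutive occurs⇔ Bad′⇔Bad (none , once) =
      (λ bad′ p occurs′ → none (to Bad′⇔Bad bad′) (σ p)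
                               (from (occurs⇔ (σ p)) (subst (D′.Occurs R′) (sym (σ-involutive p)) occurs′)))
    , (λ ¬bad′ → ∃!-transfer σ σ-involutive occurs⇔ (once (¬bad′ ∘ from Bad′⇔Bad)))
    where open Equivalence

module _ {m} (X Y : Coordinate m) where
  private
    module D  = Diagram X Y
    module Dᵀ = Diagram Y X
    module Dʳ = Diagram (reverse X) (reverse Y)

  transpose-occurs : ∀ {R p} → D.Occurs R p ⇔ Dᵀ.Occurs (map swap R) p
  transpose-occurs {R} {i , j} = mk⇔
    (λ (xi<xj , yi<yj , empty) → yi<yj , xi<xj , map⁺ (All.map (λ e k → e k ∘ swap) empty))
    (λ (yi<yj , xi<xj , empty) → xi<xj , yi<yj , All.map (λ e k → e k ∘ swap) (map⁻ empty))

  transpose-corner : ∀ c → AtCorner c Y X ⇔ AtCorner (oppositeCorner c) X Y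
  transpose-corner topLeft     = mk⇔ (Σ.map₂ swap) (Σ.map₂ swap)
  transpose-corner bottomRight = mk⇔ (Σ.map₂ swap) (Σ.map₂ swap)

  rotate-occurs : ∀ {R i j} → Dʳ.Occurs R (i , j) ⇔ D.Occurs (map rotateBox R) (j , i)
  rotate-occurs {R} {i} {j} = mk⇔
    (λ (xi<xj , yi<yj , empty) → from (x-reverses j i) xi<xj , from (y-reverses j i) yi<yj
                               , map⁺ (All.map (λ e k → e k ∘ from (inBox⇔ _ k)) empty))
    (λ (xj<xi , yj<yi , empty) → to (x-reverses j i) xj<xi , to (y-reverses j i) yj<yi
                               , All.map (λ e k → e k ∘ to (inBox⇔ _ k)) (map⁻ empty))
    where
    open Equivalence
    x-reverses : ∀ k l → D.x k < D.x l ⇔ Dʳ.x l < Dʳ.x k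
    x-reverses k l = ∸-reverses-< (value≤m X k) (value≤m X l)
    y-reverses : ∀ k l → D.y k < D.y l ⇔ Dʳ.y l < Dʳ.y k
    y-reverses k l = ∸-reverses-< (value≤m Y k) (value≤m Y l)
    inBox⇔ : ∀ box k → Dʳ.InBox box i j k ⇔ D.InBox (rotateBox box) j i k
    inBox⇔ (a , b) k = ⇔-sym (strip-reverse a (value≤m X j) (value≤m X i) (value≤m X k)
                           ×-⇔ strip-reverse b (value≤m Y j) (value≤m Y i) (value≤m Y k))

  pointAt-reverse : ∀ {a b} → a ≤ m → b ≤ m → Dʳ.PointAt a b ⇔ D.PointAt (m ∸ a) (m ∸ b)
  pointAt-reverse a≤m b≤m = mk⇔ (Σ.map₂ λ {k} → Σ.map (to (x⇔ k)) (to (y⇔ k)))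
                                 (Σ.map₂ λ {k} → Σ.map (from (x⇔ k)) (from (y⇔ k)))
    where
    open Equivalence
    x⇔ = λ k → m∸c≡a⇔c≡m∸a (value≤m X k) a≤m
    y⇔ = λ k → m∸c≡a⇔c≡m∸a (value≤m Y k) b≤m

  rotate-corner : ∀ c → AtCorner c (reverse X) (reverse Y) ⇔ AtCorner (oppositeCorner c) X Y
  rotate-corner topLeft     =
    subst (λ b → Dʳ.PointAt 0 m ⇔ D.PointAt m b) (n∸n≡0 m) (pointAt-reverse z≤n ≤-refl)
  rotate-corner bottomRight =
    subst (λ a → Dʳ.PointAt m 0 ⇔ D.PointAt a m) (n∸n≡0 m) (pointAt-reverse ≤-refl z≤n)

record CornerPattern (R : Shading) : Set where
  field
    corner     : Corner
    classified : ∀ {m} (X Y : Coordinate m) → Diagram.OccursOnceUnless X Y (AtCorner corner X Y) R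

open CornerPattern

topRow-cornerPattern : ∀ {R} → (∀ {m} (X Y : Coordinate m) → SinglesOut X Y R) → CornerPattern (topRow ++ R)
topRow-cornerPattern {R} unique-witness = record
  { corner     = topLeft
  ; classified = λ X Y → topRow-classified X Y R (unique-witness X Y)
  }

transposed : ∀ {R} → CornerPattern R → CornerPattern (map swap R)
transposed P = record
  { corner     = oppositeCorner (corner P)
  ; classified = λ X Y → occursOnceUnless-transfer Y X X Y id (λ _ → refl) (λ _ → transpose-occurs Y X)
                           (⇔-sym (transpose-corner X Y (corner P))) (classified P Y X)
  }

rotated : ∀ {R} → CornerPattern R → CornerPattern (map rotateBox R)
rotated P = record
  { corner     = oppositeCorner (corner P)
  ; classified = λ X Y → occursOnceUnless-transfer (reverse X) (reverse Y) X Y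
                           swap (λ _ → refl) (λ _ → rotate-occurs X Y)
                           (⇔-sym (rotate-corner X Y (corner P))) (classified P (reverse X) (reverse Y))
  }

SameBoxes : Shading → Shading → Set
SameBoxes R R′ = R ⊆ R′ × R′ ⊆ R

sameBoxes? : ∀ R R′ → Dec (SameBoxes R R′)
sameBoxes? R R′ = (R ⊆? R′) ×-dec (R′ ⊆? R)

sameBoxes-occurs : ∀ {m} (X Y : Coordinate m) {R R′ p} → SameBoxes R R′ →
                   Diagram.Occurs X Y R p ⇔ Diagram.Occurs X Y R′ p
sameBoxes-occurs X Y (R⊆R′ , R′⊆R) =
  mk⇔ (Σ.map₂ (Σ.map₂ (anti-mono R′⊆R))) (Σ.map₂ (Σ.map₂ (anti-mono R⊆R′)))

reordered : ∀ {R R′} → CornerPattern R → {True (sameBoxes? R R′)} → CornerPattern R′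
reordered {R} {R′} P {same} = record
  { corner     = corner P
  ; classified = λ X Y → occursOnceUnless-transfer X Y X Y id (λ _ → refl)
                           (λ _ → sameBoxes-occurs X Y (toWitness {a? = sameBoxes? R R′} same))
                           ⇔-refl (classified P X Y)
  }

topAndFirst : CornerPattern (topRow ++ (0F , 1F) ∷ (0F , 0F) ∷ [])
topAndFirst = topRow-cornerPattern singlesOut-first

topAndHighestBefore : CornerPattern (topRow ++ (0F , 1F) ∷ (1F , 1F) ∷ [])
topAndHighestBefore = topRow-cornerPattern singlesOut-highestBefore

topAndLowestBefore : CornerPattern (topRow ++ (0F , 0F) ∷ (1F , 0F) ∷ [])
topAndLowestBefore = topRow-cornerPattern singlesOut-lowestBefore

topAndPredecessor : CornerPattern (topRow ++ (1F , 1F) ∷ (1F , 0F) ∷ [])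
topAndPredecessor = topRow-cornerPattern singlesOut-predecessor

patterns-cornerPatterns : VecAll CornerPattern patterns
patterns-cornerPatterns =
    topAndHighestBefore
  ∷ reordered (rotated (transposed topAndHighestBefore))
  ∷ reordered (transposed topAndHighestBefore)
  ∷ reordered (rotated topAndHighestBefore)
  ∷ topAndFirst
  ∷ reordered (transposed topAndFirst)
  ∷ reordered (rotated (transposed topAndLowestBefore))
  ∷ topAndLowestBefore
  ∷ reordered (transposed topAndLowestBefore)
  ∷ reordered (rotated topAndLowestBefore)
  ∷ reordered (rotated (transposed topAndPredecessor))
  ∷ topAndPredecessor
  ∷ reordered (transposed topAndPredecessor)
  ∷ reordered (rotated topAndPredecessor)
  ∷ []

-- Occurrences in permutations

positions : ∀ m → Coordinate m
positions m = record { value = toℕ ; value≤m = toℕ≤pred[n] ; injective = toℕ-injective }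

values : ∀ {m} (π : Vec (Fin (suc m)) (suc m)) → T (distinct π) → Coordinate m
values π π-distinct = record
  { value     = toℕ ∘ lookup π
  ; value≤m   = toℕ≤pred[n] ∘ lookup π
  ; injective = distinct⇒lookup-injective π π-distinct ∘ toℕ-injective
  }

-- The box test local to `isOcc`, restated so that it can be named.
inBoxᵇ : ∀ {n} → Vec (Fin n) n → Fin n → Fin n → Box → Fin n → Bool
inBoxᵇ {n} π i₁ i₂ (a , b) k =
  (lookup xs (inject₁ a) <ᵇ pos k) ∧ (pos k <ᵇ lookup xs (fs a))
  ∧ (lookup ys (inject₁ b) <ᵇ val π k) ∧ (val π k <ᵇ lookup ys (fs b))
  where
  xs ys : Vec ℕ 4
  xs = 0 ∷ pos i₁ ∷ pos i₂ ∷ suc n ∷ []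
  ys = 0 ∷ val π i₁ ∷ val π i₂ ∷ suc n ∷ []

stripᵇ⇔ : ∀ {n lo hi c} a → c < n →
          let bounds = 0 ∷ suc lo ∷ suc hi ∷ suc n ∷ [] in
          (T (lookup bounds (inject₁ a) <ᵇ suc c) × T (suc c <ᵇ lookup bounds (fs a))) ⇔ Strip a lo hi c
stripᵇ⇔ 0F c<n = mk⇔ (λ (_ , c<lo) → <ᵇ⇒< _ _ c<lo) (λ c<lo → _ , <⇒<ᵇ c<lo)
stripᵇ⇔ 1F c<n = mk⇔ (Σ.map (<ᵇ⇒< _ _) (<ᵇ⇒< _ _)) (Σ.map <⇒<ᵇ <⇒<ᵇ)
stripᵇ⇔ 2F c<n = mk⇔ (λ (hi<c , _) → <ᵇ⇒< _ _ hi<c) (λ hi<c → <⇒<ᵇ hi<c , <⇒<ᵇ c<n)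

cornerPosition cornerValue : Corner → (m : ℕ) → Fin (suc m)
cornerPosition topLeft     m = fz
cornerPosition bottomRight m = fromℕ m
cornerValue    topLeft     m = fromℕ m
cornerValue    bottomRight m = fz

module _ {m} (π : Vec (Fin (suc m)) (suc m)) (π-distinct : T (distinct π)) where
  open Diagram (positions m) (values π π-distinct)
  open Equivalence

  inBoxᵇ⇔ : ∀ {i j} box k → T (inBoxᵇ π i j box k) ⇔ InBox box i j k
  inBoxᵇ⇔ (a , b) k = mk⇔
    (λ t → let tx₁ , t′ = to T-∧ t ; tx₂ , t″ = to T-∧ t′ in
           to (stripᵇ⇔ a (toℕ<n k)) (tx₁ , tx₂) , to (stripᵇ⇔ b (toℕ<n (lookup π k))) (to T-∧ t″))
    (λ (ka , kb) → let tx₁ , tx₂ = from (stripᵇ⇔ a (toℕ<n k)) ka in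
                   from T-∧ (tx₁ , from T-∧ (tx₂ , from T-∧ (from (stripᵇ⇔ b (toℕ<n (lookup π k))) kb))))

  boxEmptyᵇ⇔ : ∀ {i j} box → T (not (any (inBoxᵇ π i j box) (allFin (suc m)))) ⇔ BoxEmpty box i j
  boxEmptyᵇ⇔ box = mk⇔
    (λ t k k∈box → to T-not⇔¬T t (any⁺ (inBoxᵇ π _ _ box) (lose (∈-allFin k) (from (inBoxᵇ⇔ box k) k∈box))))
    (λ empty → from T-not⇔¬T λ t →
       let k , tk = satisfied (any⁻ (inBoxᵇ π _ _ box) (allFin (suc m)) t) in empty k (to (inBoxᵇ⇔ box k) tk))

  isOcc⇔ : ∀ R {i j} → T (isOcc R π i j) ⇔ Occurs R (i , j)
  isOcc⇔ R = mk⇔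
    (λ t → let t₁ , t′ = to T-∧ t ; t₂ , t₃ = to T-∧ t′ in
           <ᵇ⇒< _ _ t₁ , <ᵇ⇒< _ _ t₂ , All.map (to (boxEmptyᵇ⇔ _)) (all⁺ _ R t₃))
    (λ (xi<xj , yi<yj , empty) →
           from T-∧ (<⇒<ᵇ xi<xj , from T-∧ (<⇒<ᵇ yi<yj , all⁻ _ (All.map (from (boxEmptyᵇ⇔ _)) empty))))

  occ≡0 : ∀ {R} → NoOccurrence R → occ R π ≡ 0
  occ≡0 {R} none =
    countᵇ-none (λ (i , j) → dec-false (T? _) (none (i , j) ∘ to (isOcc⇔ R))) (allPairs (suc m))

  occ≡1 : ∀ {R} → UniqueOccurrence R → occ R π ≡ 1
  occ≡1 {R} unique =
    countᵇ-allPairs-unique _ (∃!-transfer id (λ _ → refl) (λ _ → ⇔-sym (isOcc⇔ R)) unique)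

  pointAt⇔lookup : ∀ l a → PointAt (toℕ l) (toℕ a) ⇔ lookup π l ≡ a
  pointAt⇔lookup l a = mk⇔
    (λ (k , k≡l , πk≡a) → subst (λ k → lookup π k ≡ a) (toℕ-injective k≡l) (toℕ-injective πk≡a))
    (λ πl≡a → l , refl , cong toℕ πl≡a)

  atCorner⇔ : ∀ c → AtCorner c (positions m) (values π π-distinct)
                  ⇔ lookup π (cornerPosition c m) ≡ cornerValue c m
  atCorner⇔ topLeft     =
    subst (λ b → PointAt 0 b ⇔ lookup π fz ≡ fromℕ m) (toℕ-fromℕ m) (pointAt⇔lookup fz (fromℕ m))
  atCorner⇔ bottomRight =
    subst (λ a → PointAt a 0 ⇔ lookup π (fromℕ m) ≡ fz) (toℕ-fromℕ m) (pointAt⇔lookup (fromℕ m) fz)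

  occ-cornerPattern : ∀ {R} (P : CornerPattern R) →
                      occ R π ≡ (if ⌊ lookup π (cornerPosition (corner P) m) ≟ cornerValue (corner P) m ⌋
                                 then 0 else 1)
  occ-cornerPattern P with lookup π (cornerPosition (corner P) m) ≟ cornerValue (corner P) m
  ... | yes at = occ≡0 (proj₁ (classified P _ _) (from (atCorner⇔ (corner P)) at))
  ... | no ¬at = occ≡1 (proj₂ (classified P _ _) (¬at ∘ to (atCorner⇔ (corner P))))

sum-occ-cornerPattern : ∀ {R} → CornerPattern R → ∀ m (h : ℕ → ℕ) →
                        sum (map (h ∘ occ R) (perms (suc m))) ≡ m ! * h 0 + (m * m !) * h 1
sum-occ-cornerPattern {R} P m h = sum-perms-by-entry m l a (h ∘ occ R) (h 0) (h 1)
  (λ π π-distinct → trans (cong h (occ-cornerPattern π π-distinct P)) (if-float h _))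
  where
  l a : Fin (suc m)
  l = cornerPosition (corner P) m
  a = cornerValue (corner P) m

s-cornerPattern : ∀ {R} → CornerPattern R → ∀ m k →
                  s R (suc m) k ≡ m ! * (if 0 ≡ᵇ k then 1 else 0) + (m * m !) * (if 1 ≡ᵇ k then 1 else 0)
s-cornerPattern {R} P m k =
  trans (countᵇ-as-sum _ (perms (suc m))) (sum-occ-cornerPattern P m (λ o → if o ≡ᵇ k then 1 else 0))

cornerPatterns-equidistributed : ∀ {R₁ R₂} → CornerPattern R₁ → CornerPattern R₂ →
                                 Equidistributed R₁ R₂
cornerPatterns-equidistributed P₁ P₂ zero    k = refl  -- the empty permutation has no pair of positions
cornerPatterns-equidistributed P₁ P₂ (suc m) k = trans (s-cornerPattern P₁ m k) (sym (s-cornerPattern P₂ m k))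

genPoly-cornerPattern : ∀ {R} → CornerPattern R → ∀ n → 1 ≤ n → ∀ q →
                        genPoly R n q ≡ (n ∸ 1) ! + q * ((n ∸ 1) * (n ∸ 1) !)
genPoly-cornerPattern {R} P (suc m) _ q = begin
  genPoly R (suc m) q             ≡⟨ sum-occ-cornerPattern P m (q ^_) ⟩
  m ! * 1 + (m * m !) * (q * 1)   ≡⟨ cong₂ _+_ (*-identityʳ (m !)) (cong ((m * m !) *_) (*-identityʳ q)) ⟩
  m ! + (m * m !) * q             ≡⟨ cong (m ! +_) (*-comm (m * m !) q) ⟩
  m ! + q * (m * m !)             ∎

theorem3p8 : ((i j : Fin 14) → Equidistributed (lookup patterns i) (lookup patterns j))
           × ((i : Fin 14) → (n : ℕ) → 1 ≤ n → (q : ℕ) →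
                genPoly (lookup patterns i) n q ≡ (n ∸ 1) ! + q * ((n ∸ 1) * (n ∸ 1) !))
theorem3p8 = (λ i j → cornerPatterns-equidistributed (cornerPattern i) (cornerPattern j))
           , (λ i → genPoly-cornerPattern (cornerPattern i))
  where
  cornerPattern : ∀ i → CornerPattern (lookup patterns i)
  cornerPattern = lookup⁺ patterns-cornerPatterns
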